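{- For an integer $n\ge 2$ let $z(n)$ denote the dimension (over $\mathbb{Q}$) of the right kernel of $C_{\mathrm{Bg}(n)}$. Then for every $n \ge 2$: $z(n+1) = z(n)+1$ if the binary representation of $n$ contains at least three $1$'s, and $z(n+1) = z(n)$ otherwise.
   Context: For an integer $n \ge 2$ let $r = \lceil \log_2 n \rceil$, and let $B$ be the $n\times r$ $0/1$ matrix whose $k$-th row ($1\le k\le n$) is the binary representation of $k-1$ written with $r$ digits. Let $M(n)$ be the symmetric $(n+r)\times(n+r)$ block matrix $\begin{pmatrix} J_n & B\\ B^T & J_r\end{pmatrix}$, where $J_i$ is the all-ones $i\times i$ matrix. The binary graph $\mathrm{Bg}(n)$ is the graph on $n+r$ vertices whose adjacency matrix is $M(n)-I$. For a graph $\Gamma$, $N[v]$ is the closed neighbourhood of a vertex $v$ and for a vertex set $S$, $\vec S$ is its $0/1$ indicator vector; the RA matrix $C_\Gamma$ is the integer matrix with one column per vertex whose rows are $\vec{N[v]}$ for all vertices $v$ together with $\overrightarrow{N[u]\cap N[v]}$ for all pairs of vertices $u,v$. -}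

module Defs where

open import Data.Bool using (Bool; true; false; not; _∧_; _∨_; if_then_else_)
open import Data.Nat using (ℕ; zero; suc; _+_; _∸_; _^_; _≡ᵇ_; _/_; _%_)
open import Data.Nat.Logarithm using (⌈log₂_⌉)
open import Data.Fin using (Fin; toℕ; splitAt; _≟_) renaming (zero to fzero; suc to fsuc)
open import Data.Sum using (_⊎_; inj₁; inj₂)
open import Data.Product using (_×_; _,_; Σ; ∃)
open import Data.List using (map; upTo)
open import Data.Nat.ListAction using (sum)
open import Data.Rational using (ℚ; 0ℚ; 1ℚ) renaming (_+_ to _+ℚ_; _*_ to _*ℚ_)
open import Relation.Nullary using (does)
open import Relation.Binary.PropositionalEquality using (_≡_)

bit : ℕ → ℕ → ℕ
bit zero    x = x % 2
bit (suc b) x = bit b (x / 2)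

-- number of 1's in the binary representation of x
-- (digits at positions ≥ x are all 0, so summing over b < x suffices)
popcount : ℕ → ℕ
popcount x = sum (map (λ b → bit b x) (upTo x))

Σℚ : (m : ℕ) → (Fin m → ℚ) → ℚ
Σℚ zero    f = 0ℚ
Σℚ (suc m) f = f fzero +ℚ Σℚ m (λ i → f (fsuc i))

-- Graphs on vertex set Fin m, given by a symmetric irreflexive adjacency

record Graph (m : ℕ) : Set where
  field
    adj : Fin m → Fin m → Bool

open Graph public

closedN : ∀ {m} → Graph m → Fin m → Fin m → Bool
closedN G v u = does (u ≟ v) ∨ adj G v u

indicator : Bool → ℚ
indicator b = if b then 1ℚ else 0ℚ

RARow : ℕ → Set
RARow m = Fin m ⊎ (Fin m × Fin m)

RA : ∀ {m} → Graph m → RARow m → Fin m → ℚ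
RA G (inj₁ v)       w = indicator (closedN G v w)
RA G (inj₂ (u , v)) w = indicator (closedN G u w ∧ closedN G v w)

InKernel : ∀ {R : Set} {m} → (R → Fin m → ℚ) → (Fin m → ℚ) → Set
InKernel {R} {m} C x = ∀ (row : R) → Σℚ m (λ w → C row w *ℚ x w) ≡ 0ℚ

lincomb : ∀ {m} d → (Fin d → Fin m → ℚ) → (Fin d → ℚ) → Fin m → ℚ
lincomb d vs c w = Σℚ d (λ i → c i *ℚ vs i w)

LinIndep : ∀ {m} d → (Fin d → Fin m → ℚ) → Set
LinIndep d vs = ∀ c → (∀ w → lincomb d vs c w ≡ 0ℚ) → ∀ i → c i ≡ 0ℚ

KernelDim : ∀ {R : Set} {m} → (R → Fin m → ℚ) → ℕ → Set
KernelDim {R} {m} C d =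
  Σ (Fin d → Fin m → ℚ) λ vs →
    (∀ i → InKernel C (vs i)) ×
    LinIndep d vs ×
    (∀ x → InKernel C x → ∃ λ c → ∀ w → x w ≡ lincomb d vs c w)

r : ℕ → ℕ
r n = ⌈log₂ n ⌉

-- entry of M(n) = [[J_n, B], [B^T, J_r]]; row k of B (k = toℕ i + 1) is the
-- binary representation of toℕ i with r digits, most significant first,
-- so column c (0-indexed) of B holds digit r-1-c.
Bentry : (n : ℕ) → Fin n → Fin (r n) → Bool
Bentry n i c = bit (r n ∸ 1 ∸ toℕ c) (toℕ i) ≡ᵇ 1

Mentry : (n : ℕ) → Fin (n + r n) → Fin (n + r n) → Bool
Mentry n x y with splitAt n x | splitAt n y
... | inj₁ i | inj₁ j = true
... | inj₂ a | inj₂ b = true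
... | inj₁ i | inj₂ c = Bentry n i c
... | inj₂ c | inj₁ i = Bentry n i c

Bg : (n : ℕ) → Graph (n + r n)
Bg n = record { adj = λ x y → Mentry n x y ∧ not (does (x ≟ y)) }

-- The kernel of C_Bg(n) consists of the vectors that vanish on the bit vertices and whose
-- restriction f to the numbers 0 … n-1 sums to zero over every set of numbers cut out by at
-- most two binary-digit conditions: the rows N[0] and N[2^k] kill the bit coordinates, and the
-- traces of the rows on the numbers are exactly these sets. Passing from n to n+1 adds the
-- coordinate of the number n, and the conditions for n+1 on vectors vanishing there are the
-- conditions for n, so z(n+1) - z(n) is 1 or 0 according as that coordinate is free or forced
-- to vanish. If n has at most two 1-digits a, b, then n is the least number having both, so the
-- condition "digits a and b" forces f(n) = 0. If n has three 1-digits a, b, c, clearing them in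
-- all eight ways and summing unit vectors with signs gives a vector with f(n) = 1 satisfying every
-- condition: a condition mentions at most two digits, and the terms cancel in pairs along one of
-- a, b, c that it does not mention.

module Submission where

open import Defs

open import Data.Bool using (Bool; true; false; _∧_)
open import Data.Bool.Properties using (∧-idem; ∧-zeroʳ; ∧-identityʳ)
open import Data.Fin using (Fin; toℕ; fromℕ; fromℕ<; inject₁; _↑ˡ_; _↑ʳ_; splitAt; opposite)
  renaming (zero to fzero; suc to fsuc)
import Data.Fin as Fin
open import Data.Fin.Properties
  using (toℕ<n; toℕ-fromℕ; toℕ-inject₁; toℕ-fromℕ<; toℕ-injective; opposite-prop; opposite-involutive;
         splitAt-↑ˡ; splitAt-↑ʳ; splitAt⁻¹-↑ˡ; splitAt⁻¹-↑ʳ)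
  renaming (suc-injective to fsuc-injective)
open import Data.List using (map; upTo; _∷ʳ_; [_])
open import Data.List.Properties using (applyUpTo-∷ʳ; map-++)
open import Data.Maybe using (Maybe; nothing; just)
open import Data.Maybe.Properties using (just-injective)
import Data.Maybe.Properties as Maybe
open import Data.Nat
  using (ℕ; zero; suc; _≟_; _+_; _*_; _^_; _≤_; _<_; _≡ᵇ_; _/_; _%_; z≤n; s≤s; ⌈_/2⌉; ⌊_/2⌋)
open import Data.Nat.DivMod
open import Data.Nat.Induction using (<-wellFounded)
open import Data.Nat.ListAction using (sum)
open import Data.Nat.ListAction.Properties using (sum-++)
open import Data.Nat.Logarithm using (⌈log₂_⌉; ⌈log₂⌉-mono-≤; ⌈log₂2^n⌉≡n)
open import Data.Nat.Logarithm.Core using (⌈log2⌉)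
open import Data.Nat.Properties
open import Data.Product using (_×_; _,_; ∃; ∃₂; proj₁; proj₂; swap)
open import Data.Rational using (ℚ; 0ℚ; 1ℚ) renaming (_+_ to _+ℚ_; _*_ to _*ℚ_; _-_ to _-ℚ_)
import Data.Rational.Properties as ℚ
open import Data.Rational.Solver using (module +-*-Solver)
open +-*-Solver using (solve; _:+_; _:*_; _:-_; _:=_)
open import Data.Sum using (_⊎_; inj₁; inj₂; [_,_]′)
import Data.Sum as Sum
open import Data.Vec.Functional using (init; last; _++_; _∷_)
open import Data.Vec.Functional.Properties using (lookup-++ˡ; lookup-++ʳ)
open import Function using (_∘_; id)
open import Induction.WellFounded using (Acc; acc)
open import Relation.Binary.Definitions using (DecidableEquality)
open import Relation.Binary.PropositionalEquality
  using (_≡_; _≢_; refl; sym; trans; cong; cong₂; subst; module ≡-Reasoning)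
open import Relation.Nullary using (Dec; yes; no; does; contradiction)
open import Relation.Nullary.Decidable using (dec-true; dec-false)

bit<2 : ∀ a x → bit a x < 2
bit<2 zero    x = m%n<n x 2
bit<2 (suc a) x = bit<2 a (x / 2)

bit≡0⊎bit≡1 : ∀ a x → bit a x ≡ 0 ⊎ bit a x ≡ 1
bit≡0⊎bit≡1 a x with bit a x | bit<2 a x
... | 0 | _ = inj₁ refl
... | 1 | _ = inj₂ refl
... | suc (suc _) | s≤s (s≤s ())

bit-0-digit : ∀ b z → b < 2 → bit 0 (b + z * 2) ≡ b
bit-0-digit b z b<2 = trans ([m+kn]%n≡m%n b z 2) (m<n⇒m%n≡m b<2)

bit-suc-digit : ∀ e b z → b < 2 → bit (suc e) (b + z * 2) ≡ bit e z
bit-suc-digit e b z b<2 = cong (bit e) (begin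
  (b + z * 2) / 2      ≡⟨ +-distrib-/ b (z * 2) (subst (_< 2) (sym digits) b<2) ⟩
  b / 2 + z * 2 / 2    ≡⟨ cong₂ _+_ (m<n⇒m/n≡0 b<2) (m*n/n≡m z 2) ⟩
  z                    ∎)
  where
  open ≡-Reasoning
  digits : b % 2 + z * 2 % 2 ≡ b
  digits = trans (cong₂ _+_ (m<n⇒m%n≡m b<2) (m*n%n≡0 z 2)) (+-identityʳ b)

bit-<2^ : ∀ a x → x < 2 ^ a → bit a x ≡ 0
bit-<2^ zero    zero    _        = refl
bit-<2^ zero    (suc x) (s≤s ())
bit-<2^ (suc a) x       x<2^1+a  =
  bit-<2^ a (x / 2) (m<n*o⇒m/o<n (subst (x <_) (*-comm 2 (2 ^ a)) x<2^1+a))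

bit-of-0 : ∀ a → bit a 0 ≡ 0
bit-of-0 a = bit-<2^ a 0 (m^n>0 2 a)

n<2^n : ∀ n → n < 2 ^ n
n<2^n zero    = s≤s z≤n
n<2^n (suc n) = ≤-<-trans (n<2^n n) (m<m+n (2 ^ n) (≤-trans (m^n>0 2 n) (m≤m+n (2 ^ n) 0)))

bit≡1⇒< : ∀ e x → bit e x ≡ 1 → e < x
bit≡1⇒< e x bit≡1 with e <? x
... | yes e<x = e<x
... | no e≮x  = contradiction (trans (sym (bit-<2^ e x x<2^e)) bit≡1) λ ()
  where
  x<2^e : x < 2 ^ e
  x<2^e = <-≤-trans (n<2^n x) (^-monoʳ-≤ 2 (≮⇒≥ e≮x))

2*m/2≡m : ∀ m → 2 * m / 2 ≡ m
2*m/2≡m m = trans (cong (_/ 2) (*-comm 2 m)) (m*n/n≡m m 2)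

bit-2^-same : ∀ k → bit k (2 ^ k) ≡ 1
bit-2^-same zero    = refl
bit-2^-same (suc k) = trans (cong (bit k) (2*m/2≡m (2 ^ k))) (bit-2^-same k)

bit-2^-other : ∀ a k → a ≢ k → bit a (2 ^ k) ≡ 0
bit-2^-other zero    zero    a≢k = contradiction refl a≢k
bit-2^-other zero    (suc k) _   = trans (cong (_% 2) (*-comm 2 (2 ^ k))) (m*n%n≡0 (2 ^ k) 2)
bit-2^-other (suc a) zero    _   = bit-of-0 a
bit-2^-other (suc a) (suc k) a≢k =
  trans (cong (bit a) (2*m/2≡m (2 ^ k))) (bit-2^-other a k (a≢k ∘ cong suc))

bits⊆⇒≤ : ∀ m n → (∀ e → bit e m ≡ 1 → bit e n ≡ 1) → m ≤ n
bits⊆⇒≤ m = go m (<-wellFounded m)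
  where
  go : ∀ m → Acc _<_ m → ∀ n → (∀ e → bit e m ≡ 1 → bit e n ≡ 1) → m ≤ n
  go zero    _        n _  = z≤n
  go (suc m) (acc rs) n m⊆n = begin
    suc m                     ≡⟨ m≡m%n+[m/n]*n (suc m) 2 ⟩
    suc m % 2 + suc m / 2 * 2 ≤⟨ +-mono-≤ lowest (*-monoˡ-≤ 2 higher) ⟩
    n % 2 + n / 2 * 2         ≡⟨ m≡m%n+[m/n]*n n 2 ⟨
    n                         ∎
    where
    open ≤-Reasoning
    higher : suc m / 2 ≤ n / 2
    higher = go (suc m / 2) (rs (m/n<m (suc m) 2 ≤-refl)) (n / 2) (λ e → m⊆n (suc e))
    lowest : suc m % 2 ≤ n % 2
    lowest with bit≡0⊎bit≡1 0 (suc m)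
    ... | inj₁ m₀≡0 = subst (_≤ n % 2) (sym m₀≡0) z≤n
    ... | inj₂ m₀≡1 = ≤-reflexive (trans m₀≡1 (sym (m⊆n 0 m₀≡1)))

clearBit : ℕ → ℕ → ℕ
clearBit zero    x = 0 + x / 2 * 2
clearBit (suc t) x = x % 2 + clearBit t (x / 2) * 2

bit-clearBit-same : ∀ t x → bit t (clearBit t x) ≡ 0
bit-clearBit-same zero    x = bit-0-digit 0 (x / 2) (s≤s z≤n)
bit-clearBit-same (suc t) x =
  trans (bit-suc-digit t (x % 2) (clearBit t (x / 2)) (m%n<n x 2)) (bit-clearBit-same t (x / 2))

bit-clearBit-other : ∀ e t x → e ≢ t → bit e (clearBit t x) ≡ bit e x
bit-clearBit-other zero    zero    x e≢t = contradiction refl e≢t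
bit-clearBit-other zero    (suc t) x _   = bit-0-digit (x % 2) (clearBit t (x / 2)) (m%n<n x 2)
bit-clearBit-other (suc e) zero    x _   = bit-suc-digit e 0 (x / 2) (s≤s z≤n)
bit-clearBit-other (suc e) (suc t) x e≢t =
  trans (bit-suc-digit e (x % 2) (clearBit t (x / 2)) (m%n<n x 2)) (bit-clearBit-other e t (x / 2) (e≢t ∘ cong suc))

clearBit-≤ : ∀ t x → clearBit t x ≤ x
clearBit-≤ t x = ≤-trans (go t x) (≤-reflexive (sym (m≡m%n+[m/n]*n x 2)))
  where
  go : ∀ t x → clearBit t x ≤ x % 2 + x / 2 * 2
  go zero    x = +-monoˡ-≤ (x / 2 * 2) z≤n
  go (suc t) x = +-monoʳ-≤ (x % 2) (*-monoˡ-≤ 2 (clearBit-≤ t (x / 2)))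

clearBit-< : ∀ t x → bit t x ≡ 1 → clearBit t x < x
clearBit-< t x bit≡1 = ≤∧≢⇒< (clearBit-≤ t x) λ eq →
  contradiction (trans (sym (bit-clearBit-same t x)) (trans (cong (bit t) eq) bit≡1)) λ ()

n≤2*⌈n/2⌉ : ∀ n → n ≤ 2 * ⌈ n /2⌉
n≤2*⌈n/2⌉ n = begin
  n                  ≡⟨ ⌊n/2⌋+⌈n/2⌉≡n n ⟨
  ⌊ n /2⌋ + ⌈ n /2⌉  ≤⟨ +-monoˡ-≤ ⌈ n /2⌉ (⌊n/2⌋≤⌈n/2⌉ n) ⟩
  ⌈ n /2⌉ + ⌈ n /2⌉  ≡⟨ cong (⌈ n /2⌉ +_) (+-identityʳ ⌈ n /2⌉) ⟨
  2 * ⌈ n /2⌉        ∎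
  where open ≤-Reasoning

n≤2^⌈log₂n⌉ : ∀ n → n ≤ 2 ^ ⌈log₂ n ⌉
n≤2^⌈log₂n⌉ n = go n (<-wellFounded n)
  where
  open ≤-Reasoning
  go : ∀ n (rec : Acc _<_ n) → n ≤ 2 ^ ⌈log2⌉ n rec
  go 0             _        = z≤n
  go 1             _        = ≤-refl
  go (suc (suc n)) (acc rs) = begin
    2 + n                                ≤⟨ s≤s (s≤s (n≤2*⌈n/2⌉ n)) ⟩
    2 + 2 * ⌈ n /2⌉                      ≡⟨ *-suc 2 ⌈ n /2⌉ ⟨
    2 * suc ⌈ n /2⌉                      ≤⟨ *-monoʳ-≤ 2 (go (suc ⌈ n /2⌉) (rs (⌈n/2⌉<n n))) ⟩
    2 * 2 ^ ⌈log2⌉ (suc ⌈ n /2⌉) _       ∎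

<⌈log₂⌉⇒2^< : ∀ {k n} → k < ⌈log₂ n ⌉ → 2 ^ k < n
<⌈log₂⌉⇒2^< {k} {n} k<⌈log₂n⌉ with 2 ^ k <? n
... | yes 2^k<n = 2^k<n
... | no  2^k≮n = contradiction (⌈log₂⌉-mono-≤ (≮⇒≥ 2^k≮n))
  (<⇒≱ (subst (_< ⌈log₂ n ⌉) (sym (⌈log₂2^n⌉≡n k)) k<⌈log₂n⌉))

bit-≥⌈log₂⌉ : ∀ {a i n} → i < n → ⌈log₂ n ⌉ ≤ a → bit a i ≡ 0
bit-≥⌈log₂⌉ {a} {i} {n} i<n ⌈log₂n⌉≤a =
  bit-<2^ a i (<-≤-trans i<n (≤-trans (n≤2^⌈log₂n⌉ n) (^-monoʳ-≤ 2 ⌈log₂n⌉≤a)))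

countBelow : ℕ → (ℕ → ℕ) → ℕ
countBelow k f = sum (map f (upTo k))

countBelow-suc : ∀ k f → countBelow (suc k) f ≡ countBelow k f + f k
countBelow-suc k f = begin
  sum (map f (upTo (suc k)))          ≡⟨ cong (sum ∘ map f) (applyUpTo-∷ʳ id k) ⟨
  sum (map f (upTo k ∷ʳ k))           ≡⟨ cong sum (map-++ f (upTo k) [ k ]) ⟩
  sum (map f (upTo k) ∷ʳ f k)         ≡⟨ sum-++ (map f (upTo k)) [ f k ] ⟩
  countBelow k f + (f k + 0)          ≡⟨ cong (countBelow k f +_) (+-identityʳ (f k)) ⟩
  countBelow k f + f k                ∎
  where open ≡-Reasoning

countBelow≡0 : ∀ {k f e} → countBelow k f ≡ 0 → e < k → f e ≡ 0
countBelow≡0 {suc k} {f} {e} count≡0 e<1+k with m≤n⇒m<n∨m≡n (≤-pred e<1+k)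
... | inj₁ e<k  = countBelow≡0 (m+n≡0⇒m≡0 (countBelow k f) (trans (sym (countBelow-suc k f)) count≡0)) e<k
... | inj₂ refl = m+n≡0⇒n≡0 (countBelow k f) (trans (sym (countBelow-suc k f)) count≡0)

noOnesBelow : ∀ {c f e} → countBelow c f ≡ 0 → f e ≡ 1 → e ≤ c → e ≡ c
noOnesBelow count≡0 fe≡1 e≤c with m≤n⇒m<n∨m≡n e≤c
... | inj₁ e<c = contradiction (trans (sym fe≡1) (countBelow≡0 count≡0 e<c)) λ ()
... | inj₂ e≡c = e≡c

highestOne : ∀ {k j f} → (∀ e → f e ≡ 0 ⊎ f e ≡ 1) → countBelow k f ≡ suc j →
  ∃ λ c → c < k × f c ≡ 1 × countBelow c f ≡ j × (∀ e → e < k → f e ≡ 1 → e ≤ c)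
highestOne {suc k} {j} {f} binary count≡1+j with binary k
... | inj₂ fk≡1 = k , ≤-refl , fk≡1 , suc-injective (trans (+-comm 1 (countBelow k f)) (below 1 fk≡1)) ,
  λ _ e<1+k _ → ≤-pred e<1+k
  where
  below : ∀ b → f k ≡ b → countBelow k f + b ≡ suc j
  below b refl = trans (sym (countBelow-suc k f)) count≡1+j
... | inj₁ fk≡0
  with c , c<k , fc≡1 , below-c , highest ← highestOne {k = k} binary
    (trans (sym (+-identityʳ (countBelow k f)))
      (subst (λ b → countBelow k f + b ≡ suc j) fk≡0 (trans (sym (countBelow-suc k f)) count≡1+j)))
  = c , m<n⇒m<1+n c<k , fc≡1 , below-c , highest′
  where
  highest′ : ∀ e → e < suc k → f e ≡ 1 → e ≤ c
  highest′ e e<1+k fe≡1 with m≤n⇒m<n∨m≡n (≤-pred e<1+k)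
  ... | inj₁ e<k  = highest e e<k fe≡1
  ... | inj₂ refl = contradiction (trans (sym fk≡0) fe≡1) λ ()

popcount≥3⇒threeBits : ∀ n → 3 ≤ popcount n →
  ∃ λ a → ∃ λ b → ∃ λ c → a < b × b < c × bit a n ≡ 1 × bit b n ≡ 1 × bit c n ≡ 1
popcount≥3⇒threeBits n 3≤pop with popcount n in pop≡ | 3≤pop
... | suc (suc (suc j)) | _
  with c , _ , bc , below-c , _ ← highestOne {k = n} (λ e → bit≡0⊎bit≡1 e n) pop≡
  with b , b<c , bb , below-b , _ ← highestOne {k = c} (λ e → bit≡0⊎bit≡1 e n) below-c
  with a , a<b , ba , _ , _ ← highestOne {k = b} (λ e → bit≡0⊎bit≡1 e n) below-b
  = a , b , c , a<b , b<c , ba , bb , bc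
... | 1 | s≤s ()
... | 2 | s≤s (s≤s ())

popcount<3⇒twoBits : ∀ n → 0 < n → popcount n < 3 →
  ∃₂ λ a b → bit a n ≡ 1 × bit b n ≡ 1 × (∀ e → bit e n ≡ 1 → e ≡ a ⊎ e ≡ b)
popcount<3⇒twoBits n 0<n pop<3 with popcount n in pop≡
... | 0 = contradiction (bits⊆⇒≤ n 0 noBits) (<⇒≱ 0<n)
  where
  noBits : ∀ e → bit e n ≡ 1 → bit e 0 ≡ 1
  noBits e be≡1 = contradiction (trans (sym be≡1) (countBelow≡0 pop≡ (bit≡1⇒< e n be≡1))) λ ()
... | 1 with c , _ , bc , below-c , highest-c ← highestOne {k = n} (λ e → bit≡0⊎bit≡1 e n) pop≡
  = c , c , bc , bc , λ e be≡1 → inj₁ (noOnesBelow below-c be≡1 (highest-c e (bit≡1⇒< e n be≡1) be≡1))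
... | 2 with b , _ , bb , below-b , highest-b ← highestOne {k = n} (λ e → bit≡0⊎bit≡1 e n) pop≡
  with a , _ , ba , below-a , highest-a ← highestOne {k = b} (λ e → bit≡0⊎bit≡1 e n) below-b
  = a , b , ba , bb , ones
  where
  ones : ∀ e → bit e n ≡ 1 → e ≡ a ⊎ e ≡ b
  ones e be≡1 with m≤n⇒m<n∨m≡n (highest-b e (bit≡1⇒< e n be≡1) be≡1)
  ... | inj₁ e<b = inj₁ (noOnesBelow below-a be≡1 (highest-a e e<b be≡1))
  ... | inj₂ e≡b = inj₂ e≡b
... | suc (suc (suc _)) = contradiction pop<3 λ { (s≤s (s≤s (s≤s ()))) }

popcount<3⇒leastWithBits : ∀ n → 0 < n → popcount n < 3 →
  ∃₂ λ a b → bit a n ≡ 1 × bit b n ≡ 1 × (∀ j → bit a j ≡ 1 → bit b j ≡ 1 → n ≤ j)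
popcount<3⇒leastWithBits n 0<n pop<3 with popcount<3⇒twoBits n 0<n pop<3
... | a , b , ba , bb , ones = a , b , ba , bb , λ j baj bbj → bits⊆⇒≤ n j λ where
  e be≡1 → [ (λ { refl → baj }) , (λ { refl → bbj }) ]′ (ones e be≡1)

pigeonhole : ∀ {A : Set} → DecidableEquality A → ∀ {x y z : A} → x ≢ y → x ≢ z → y ≢ z →
  ∀ u v → (u ≢ x × v ≢ x) ⊎ (u ≢ y × v ≢ y) ⊎ (u ≢ z × v ≢ z)
pigeonhole _≟_ {x} {y} {z} x≢y x≢z y≢z u v = go (u ≟ x) (v ≟ x)
  where
  besides : ∀ {w} → w ≡ x → ∀ w′ → (w ≢ y × w′ ≢ y) ⊎ (w ≢ z × w′ ≢ z)
  besides refl w′ with w′ ≟ y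
  ... | no  w′≢y = inj₁ (x≢y , w′≢y)
  ... | yes refl = inj₂ (x≢z , y≢z)
  go : Dec (u ≡ x) → Dec (v ≡ x) → (u ≢ x × v ≢ x) ⊎ (u ≢ y × v ≢ y) ⊎ (u ≢ z × v ≢ z)
  go (no u≢x)  (no v≢x)  = inj₁ (u≢x , v≢x)
  go (yes u≡x) _         = inj₂ (besides u≡x v)
  go (no _)    (yes v≡x) = inj₂ (Sum.map swap swap (besides v≡x u))

vertexView : ∀ m {k} (u : Fin (m + k)) → (∃ λ j → j ↑ˡ k ≡ u) ⊎ (∃ λ c → m ↑ʳ c ≡ u)
vertexView m u with splitAt m u in split≡
... | inj₁ j = inj₁ (j , splitAt⁻¹-↑ˡ split≡)
... | inj₂ c = inj₂ (c , splitAt⁻¹-↑ʳ split≡)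

++-ext : ∀ {A : Set} m {k} {f g : Fin (m + k) → A} →
  (∀ i → f (i ↑ˡ k) ≡ g (i ↑ˡ k)) → (∀ c → f (m ↑ʳ c) ≡ g (m ↑ʳ c)) → ∀ w → f w ≡ g w
++-ext m left right w with vertexView m w
... | inj₁ (i , refl) = left i
... | inj₂ (c , refl) = right c

extend₀ : ∀ {n} → (Fin n → ℚ) → Fin (suc n) → ℚ
extend₀ {zero}  _ _        = 0ℚ
extend₀ {suc n} f fzero    = f fzero
extend₀ {suc n} f (fsuc j) = extend₀ (f ∘ fsuc) j

init-extend₀ : ∀ {n} (f : Fin n → ℚ) i → init (extend₀ f) i ≡ f i
init-extend₀ {suc n} f fzero    = refl
init-extend₀ {suc n} f (fsuc i) = init-extend₀ (f ∘ fsuc) i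

last-extend₀ : ∀ {n} (f : Fin n → ℚ) → last (extend₀ f) ≡ 0ℚ
last-extend₀ {zero}  f = refl
last-extend₀ {suc n} f = last-extend₀ (f ∘ fsuc)

init-last-ext : ∀ {A : Set} {n} {f g : Fin (suc n) → A} →
  (∀ i → init f i ≡ init g i) → last f ≡ last g → ∀ i → f i ≡ g i
init-last-ext {n = zero}  _     last≡ fzero    = last≡
init-last-ext {n = suc n} init≗ _     fzero    = init≗ fzero
init-last-ext {n = suc n} init≗ last≡ (fsuc i) = init-last-ext (init≗ ∘ fsuc) last≡ i

Σℚ-cong : ∀ m {f g : Fin m → ℚ} → (∀ i → f i ≡ g i) → Σℚ m f ≡ Σℚ m g
Σℚ-cong zero    _   = refl
Σℚ-cong (suc m) f≗g = cong₂ _+ℚ_ (f≗g fzero) (Σℚ-cong m (f≗g ∘ fsuc))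

Σℚ-zero : ∀ m {f : Fin m → ℚ} → (∀ i → f i ≡ 0ℚ) → Σℚ m f ≡ 0ℚ
Σℚ-zero zero    _   = refl
Σℚ-zero (suc m) f≗0 = cong₂ _+ℚ_ (f≗0 fzero) (Σℚ-zero m (f≗0 ∘ fsuc))

Σℚ-single : ∀ {m} {f : Fin m → ℚ} i₀ → (∀ i → i ≢ i₀ → f i ≡ 0ℚ) → Σℚ m f ≡ f i₀
Σℚ-single {suc m} {f} fzero      others = trans
  (cong (f fzero +ℚ_) (Σℚ-zero m λ i → others (fsuc i) λ ()))
  (ℚ.+-identityʳ (f fzero))
Σℚ-single {suc m} {f} (fsuc i₀) others = trans
  (cong₂ _+ℚ_ (others fzero λ ()) (Σℚ-single i₀ λ i i≢i₀ → others (fsuc i) (i≢i₀ ∘ fsuc-injective)))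
  (ℚ.+-identityˡ (f (fsuc i₀)))

Σℚ-distrib-- : ∀ m (f g : Fin m → ℚ) → Σℚ m (λ i → f i -ℚ g i) ≡ Σℚ m f -ℚ Σℚ m g
Σℚ-distrib-- zero    f g = refl
Σℚ-distrib-- (suc m) f g = trans
  (cong (f fzero -ℚ g fzero +ℚ_) (Σℚ-distrib-- m (f ∘ fsuc) (g ∘ fsuc)))
  (solve 4 (λ a b c d → (a :- b) :+ (c :- d) := (a :+ c) :- (b :+ d)) refl
    (f fzero) (g fzero) (Σℚ m (f ∘ fsuc)) (Σℚ m (g ∘ fsuc)))

Σℚ-*-distribˡ : ∀ m k (f : Fin m → ℚ) → Σℚ m (λ i → k *ℚ f i) ≡ k *ℚ Σℚ m f
Σℚ-*-distribˡ zero    k f = sym (ℚ.*-zeroʳ k)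
Σℚ-*-distribˡ (suc m) k f = trans
  (cong (k *ℚ f fzero +ℚ_) (Σℚ-*-distribˡ m k (f ∘ fsuc)))
  (sym (ℚ.*-distribˡ-+ k (f fzero) (Σℚ m (f ∘ fsuc))))

Σℚ-++ : ∀ m k (f : Fin (m + k) → ℚ) → Σℚ (m + k) f ≡ Σℚ m (f ∘ (_↑ˡ k)) +ℚ Σℚ k (f ∘ (m ↑ʳ_))
Σℚ-++ zero    k f = sym (ℚ.+-identityˡ (Σℚ k f))
Σℚ-++ (suc m) k f = trans
  (cong (f fzero +ℚ_) (Σℚ-++ m k (f ∘ fsuc)))
  (sym (ℚ.+-assoc (f fzero) (Σℚ m (f ∘ fsuc ∘ (_↑ˡ k))) (Σℚ k (f ∘ fsuc ∘ (m ↑ʳ_)))))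

Σℚ-init-last : ∀ m (f : Fin (suc m) → ℚ) → Σℚ (suc m) f ≡ Σℚ m (init f) +ℚ last f
Σℚ-init-last zero    f = trans (ℚ.+-identityʳ (f fzero)) (sym (ℚ.+-identityˡ (f fzero)))
Σℚ-init-last (suc m) f = trans
  (cong (f fzero +ℚ_) (Σℚ-init-last m (f ∘ fsuc)))
  (sym (ℚ.+-assoc (f fzero) (Σℚ m (init (f ∘ fsuc))) (last f)))

record HyperplaneBasis {R : Set} {m} (C : R → Fin m → ℚ) (w₀ : Fin m) (d : ℕ) : Set where
  field
    vectors     : Fin d → Fin m → ℚ
    inKernel    : ∀ i → InKernel C (vectors i)
    vanish      : ∀ i → vectors i w₀ ≡ 0ℚ
    independent : LinIndep d vectors
    spans       : ∀ x → InKernel C x → x w₀ ≡ 0ℚ → ∃ λ c → ∀ w → x w ≡ lincomb d vectors c w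

lincomb-zero : ∀ {m} d (vs : Fin d → Fin m → ℚ) c w → (∀ i → vs i w ≡ 0ℚ) → lincomb d vs c w ≡ 0ℚ
lincomb-zero d vs c w vs≡0 = Σℚ-zero d λ i → trans (cong (c i *ℚ_) (vs≡0 i)) (ℚ.*-zeroʳ (c i))

inKernel-sub-scaled : ∀ {R : Set} {m} (C : R → Fin m → ℚ) {x z} → InKernel C x → InKernel C z →
  ∀ k → InKernel C (λ w → x w -ℚ k *ℚ z w)
inKernel-sub-scaled {m = m} C {x} {z} Cx≡0 Cz≡0 k row = begin
  Σℚ m (λ w → C row w *ℚ (x w -ℚ k *ℚ z w))               ≡⟨ Σℚ-cong m (λ w →
    solve 4 (λ a p q k → a :* (p :- k :* q) := a :* p :- k :* (a :* q)) refl (C row w) (x w) (z w) k) ⟩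
  Σℚ m (λ w → Cx w -ℚ k *ℚ Cz w)                          ≡⟨ Σℚ-distrib-- m Cx (λ w → k *ℚ Cz w) ⟩
  Σℚ m Cx -ℚ Σℚ m (λ w → k *ℚ Cz w)                       ≡⟨ cong (Σℚ m Cx -ℚ_) (Σℚ-*-distribˡ m k Cz) ⟩
  Σℚ m Cx -ℚ k *ℚ Σℚ m Cz                                 ≡⟨ cong₂ (λ p q → p -ℚ k *ℚ q) (Cx≡0 row) (Cz≡0 row) ⟩
  0ℚ -ℚ k *ℚ 0ℚ                                           ≡⟨ cong (0ℚ -ℚ_) (ℚ.*-zeroʳ k) ⟩
  0ℚ                                                      ∎
  where
  open ≡-Reasoning
  Cx Cz : Fin m → ℚ
  Cx w = C row w *ℚ x w
  Cz w = C row w *ℚ z w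

hyperplaneBasis⇒kernelDim : ∀ {R : Set} {m} {C : R → Fin m → ℚ} {w₀ d} → HyperplaneBasis C w₀ d →
  (∀ x → InKernel C x → x w₀ ≡ 0ℚ) → KernelDim C d
hyperplaneBasis⇒kernelDim basis kernel⊆hyperplane =
  vectors , inKernel , independent , λ x Cx → spans x Cx (kernel⊆hyperplane x Cx)
  where open HyperplaneBasis basis

module _ {R : Set} {m} {C : R → Fin m → ℚ} {w₀ d} (basis : HyperplaneBasis C w₀ d)
         (V : Fin m → ℚ) (V₀≡1 : V w₀ ≡ 1ℚ) where

  open HyperplaneBasis basis
  open ≡-Reasoning

  hyperplaneBasis-∷-independent : LinIndep (suc d) (V ∷ vectors)
  hyperplaneBasis-∷-independent c comb≡0 fzero = begin
    c fzero                                    ≡⟨ ℚ.*-identityʳ (c fzero) ⟨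
    c fzero *ℚ 1ℚ                              ≡⟨ cong (c fzero *ℚ_) V₀≡1 ⟨
    c fzero *ℚ V w₀                            ≡⟨ ℚ.+-identityʳ (c fzero *ℚ V w₀) ⟨
    c fzero *ℚ V w₀ +ℚ 0ℚ                      ≡⟨ cong (c fzero *ℚ V w₀ +ℚ_)
                                                    (lincomb-zero d vectors (c ∘ fsuc) w₀ vanish) ⟨
    lincomb (suc d) (V ∷ vectors) c w₀         ≡⟨ comb≡0 w₀ ⟩
    0ℚ                                         ∎
  hyperplaneBasis-∷-independent c comb≡0 (fsuc i) = independent (c ∘ fsuc) rest≡0 i
    where
    rest≡0 : ∀ w → lincomb d vectors (c ∘ fsuc) w ≡ 0ℚ
    rest≡0 w = begin
      lincomb d vectors (c ∘ fsuc) w           ≡⟨ ℚ.+-identityˡ _ ⟨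
      0ℚ +ℚ lincomb d vectors (c ∘ fsuc) w     ≡⟨ cong (_+ℚ lincomb d vectors (c ∘ fsuc) w)
                                                    (trans (cong (_*ℚ V w) (hyperplaneBasis-∷-independent c comb≡0 fzero))
                                                      (ℚ.*-zeroˡ (V w))) ⟨
      lincomb (suc d) (V ∷ vectors) c w        ≡⟨ comb≡0 w ⟩
      0ℚ                                       ∎

  hyperplaneBasis-∷-spans : InKernel C V → ∀ x → InKernel C x → ∃ λ c → ∀ w → x w ≡ lincomb (suc d) (V ∷ vectors) c w
  hyperplaneBasis-∷-spans CV x Cx = t ∷ proj₁ x′-decomposition , λ w → begin
      x w                                      ≡⟨ solve 3 (λ p t v → p := t :* v :+ (p :- t :* v)) refl
                                                    (x w) t (V w) ⟩
      t *ℚ V w +ℚ x′ w                         ≡⟨ cong (t *ℚ V w +ℚ_) (proj₂ x′-decomposition w) ⟩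
      lincomb (suc d) (V ∷ vectors) (t ∷ proj₁ x′-decomposition) w ∎
    where
    t : ℚ
    t = x w₀
    x′ : Fin m → ℚ
    x′ w = x w -ℚ t *ℚ V w
    x′₀≡0 : x′ w₀ ≡ 0ℚ
    x′₀≡0 = trans (cong (λ v → t -ℚ t *ℚ v) V₀≡1)
      (trans (cong (t -ℚ_) (ℚ.*-identityʳ t)) (ℚ.+-inverseʳ t))
    x′-decomposition : ∃ λ c → ∀ w → x′ w ≡ lincomb d vectors c w
    x′-decomposition = spans x′ (inKernel-sub-scaled C Cx CV t) x′₀≡0

  hyperplaneBasis⇒kernelDim-suc : InKernel C V → KernelDim C (suc d)
  hyperplaneBasis⇒kernelDim-suc CV = V ∷ vectors , inKernel′ , hyperplaneBasis-∷-independent , hyperplaneBasis-∷-spans CV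
    where
    inKernel′ : ∀ i → InKernel C ((V ∷ vectors) i)
    inKernel′ fzero    = CV
    inKernel′ (fsuc i) = inKernel i

Δ : ℕ → (ℕ → ℚ) → ℕ → ℚ
Δ t g p = g p -ℚ g (clearBit t p)

Δ³ : ℕ → ℕ → ℕ → (ℕ → ℚ) → ℕ → ℚ
Δ³ a b c g = Δ a (Δ b (Δ c g))

IgnoresBit : ℕ → (ℕ → ℚ) → Set
IgnoresBit t g = ∀ p q → (∀ e → e ≢ t → bit e p ≡ bit e q) → g p ≡ g q

zero-ignoresBit : ∀ {t g} → (∀ p → g p ≡ 0ℚ) → IgnoresBit t g
zero-ignoresBit g≗0 p q _ = trans (g≗0 p) (sym (g≗0 q))

Δ-ignoresBit : ∀ {t g} s → IgnoresBit t g → IgnoresBit t (Δ s g)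
Δ-ignoresBit {t} s ignores p q agree =
  cong₂ _-ℚ_ (ignores p q agree) (ignores (clearBit s p) (clearBit s q) agree′)
  where
  agree′ : ∀ e → e ≢ t → bit e (clearBit s p) ≡ bit e (clearBit s q)
  agree′ e e≢t with e ≟ s
  ... | yes refl = trans (bit-clearBit-same s p) (sym (bit-clearBit-same s q))
  ... | no  e≢s  = trans (bit-clearBit-other e s p e≢s)
                     (trans (agree e e≢t) (sym (bit-clearBit-other e s q e≢s)))

Δ-ignored : ∀ t {g} → IgnoresBit t g → ∀ p → Δ t g p ≡ 0ℚ
Δ-ignored t {g} ignores p = trans
  (cong (g p -ℚ_) (ignores (clearBit t p) p λ e e≢t → bit-clearBit-other e t p e≢t))
  (ℚ.+-inverseʳ (g p))

Δ³-ignored : ∀ {a b c g} → IgnoresBit a g ⊎ IgnoresBit b g ⊎ IgnoresBit c g →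
  ∀ p → Δ³ a b c g p ≡ 0ℚ
Δ³-ignored {a} {b} {c} (inj₁ ignores-a) =
  Δ-ignored a (Δ-ignoresBit b (Δ-ignoresBit c ignores-a))
Δ³-ignored {a} {b} {c} (inj₂ (inj₁ ignores-b)) =
  Δ-ignored a (zero-ignoresBit (Δ-ignored b (Δ-ignoresBit c ignores-b)))
Δ³-ignored {a} {b} {c} (inj₂ (inj₂ ignores-c)) =
  Δ-ignored a (zero-ignoresBit (Δ-ignored b (zero-ignoresBit (Δ-ignored c ignores-c))))

Δ-cong : ∀ t {g h} → (∀ q → g q ≡ h q) → ∀ p → Δ t g p ≡ Δ t h p
Δ-cong t g≗h p = cong₂ _-ℚ_ (g≗h p) (g≗h (clearBit t p))

Δ-cong-≤ : ∀ t {g h p} → (∀ q → q ≤ p → g q ≡ h q) → ∀ q → q ≤ p → Δ t g q ≡ Δ t h q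
Δ-cong-≤ t g≗h q q≤p = cong₂ _-ℚ_ (g≗h q q≤p) (g≗h (clearBit t q) (≤-trans (clearBit-≤ t q) q≤p))

Δ³-cong-≤ : ∀ a b c {g h} p → (∀ q → q ≤ p → g q ≡ h q) → Δ³ a b c g p ≡ Δ³ a b c h p
Δ³-cong-≤ a b c p g≗h = Δ-cong-≤ a (Δ-cong-≤ b (Δ-cong-≤ c g≗h)) p ≤-refl

Δ-vanishesBelow : ∀ t {g p} → (∀ q → q < p → g q ≡ 0ℚ) → ∀ q → q < p → Δ t g q ≡ 0ℚ
Δ-vanishesBelow t g≗0 q q<p =
  cong₂ _-ℚ_ (g≗0 q q<p) (g≗0 (clearBit t q) (≤-<-trans (clearBit-≤ t q) q<p))

Δ-top : ∀ t {g p} → (∀ q → q < p → g q ≡ 0ℚ) → bit t p ≡ 1 → Δ t g p ≡ g p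
Δ-top t {g} {p} g≗0 bt≡1 =
  trans (cong (g p -ℚ_) (g≗0 (clearBit t p) (clearBit-< t p bt≡1))) (ℚ.+-identityʳ (g p))

Δ³-top : ∀ a b c {g p} → (∀ q → q < p → g q ≡ 0ℚ) →
  bit a p ≡ 1 → bit b p ≡ 1 → bit c p ≡ 1 → Δ³ a b c g p ≡ g p
Δ³-top a b c g≗0 ba bb bc =
  trans (Δ-top a (Δ-vanishesBelow b (Δ-vanishesBelow c g≗0)) ba)
    (trans (Δ-top b (Δ-vanishesBelow c g≗0) bb) (Δ-top c g≗0 bc))

Σℚ-Δ : ∀ m t (k : Fin m → ℚ) (g : Fin m → ℕ → ℚ) p →
  Σℚ m (λ i → k i *ℚ Δ t (g i) p) ≡ Δ t (λ q → Σℚ m (λ i → k i *ℚ g i q)) p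
Σℚ-Δ m t k g p = trans
  (Σℚ-cong m λ i → solve 3 (λ k x y → k :* (x :- y) := k :* x :- k :* y) refl
    (k i) (g i p) (g i (clearBit t p)))
  (Σℚ-distrib-- m (λ i → k i *ℚ g i p) (λ i → k i *ℚ g i (clearBit t p)))

Σℚ-Δ³ : ∀ m a b c (k : Fin m → ℚ) (g : Fin m → ℕ → ℚ) p →
  Σℚ m (λ i → k i *ℚ Δ³ a b c (g i) p) ≡ Δ³ a b c (λ q → Σℚ m (λ i → k i *ℚ g i q)) p
Σℚ-Δ³ m a b c k g p = trans (Σℚ-Δ m a k (Δ b ∘ Δ c ∘ g) p)
  (Δ-cong a (λ q → trans (Σℚ-Δ m b k (Δ c ∘ g) q)
    (Δ-cong b (Σℚ-Δ m c k g) q)) p)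

testBit : ℕ → ℕ → Bool
testBit a k = bit a k ≡ᵇ 1

testBit⇒bit≡1 : ∀ a k → testBit a k ≡ true → bit a k ≡ 1
testBit⇒bit≡1 a k test with bit a k ≟ 1
... | yes bit≡1 = bit≡1
... | no  bit≢1 = contradiction (trans (sym test) (dec-false (bit a k ≟ 1) bit≢1)) λ ()

hasBit : Maybe ℕ → ℕ → Bool
hasBit nothing  _ = true
hasBit (just a) k = testBit a k

hasBits : Maybe ℕ → Maybe ℕ → ℕ → Bool
hasBits s t k = hasBit s k ∧ hasBit t k

hasBit-ignores : ∀ {s t} → s ≢ just t → ∀ p q → (∀ e → e ≢ t → bit e p ≡ bit e q) →
  hasBit s p ≡ hasBit s q
hasBit-ignores {nothing} _      p q _     = refl
hasBit-ignores {just a}  a≢t    p q agree = cong (_≡ᵇ 1) (agree a (a≢t ∘ cong just))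

hasBits-ignoresBit : ∀ {s t e} → s ≢ just e → t ≢ just e → IgnoresBit e (indicator ∘ hasBits s t)
hasBits-ignoresBit s≢e t≢e p q agree =
  cong indicator (cong₂ _∧_ (hasBit-ignores s≢e p q agree) (hasBit-ignores t≢e p q agree))

Bentry≡testBit : ∀ n i c → Bentry n i c ≡ testBit (toℕ (opposite c)) (toℕ i)
Bentry≡testBit n i c = cong (λ k → testBit k (toℕ i))
  (trans (∸-+-assoc (r n) 1 (toℕ c)) (sym (opposite-prop c)))

Mentry-numbers : ∀ n (i j : Fin n) → Mentry n (i ↑ˡ r n) (j ↑ˡ r n) ≡ true
Mentry-numbers n i j rewrite splitAt-↑ˡ n i (r n) | splitAt-↑ˡ n j (r n) = refl

Mentry-number-bit : ∀ n (i : Fin n) c → Mentry n (i ↑ˡ r n) (n ↑ʳ c) ≡ Bentry n i c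
Mentry-number-bit n i c rewrite splitAt-↑ˡ n i (r n) | splitAt-↑ʳ n (r n) c = refl

Mentry-bit-number : ∀ n (i : Fin n) c → Mentry n (n ↑ʳ c) (i ↑ˡ r n) ≡ Bentry n i c
Mentry-bit-number n i c rewrite splitAt-↑ˡ n i (r n) | splitAt-↑ʳ n (r n) c = refl

Mentry-diag : ∀ n x → Mentry n x x ≡ true
Mentry-diag n x with splitAt n x
... | inj₁ _ = refl
... | inj₂ _ = refl

closedN-Bg : ∀ n v u → closedN (Bg n) v u ≡ Mentry n v u
closedN-Bg n v u with u Fin.≟ v
... | yes refl = sym (Mentry-diag n u)
... | no  u≢v  rewrite dec-false (v Fin.≟ u) (u≢v ∘ sym) = ∧-identityʳ (Mentry n v u)

Trace : ∀ n → Fin (n + r n) → Maybe ℕ → Set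
Trace n u s = ∀ i → closedN (Bg n) u (i ↑ˡ r n) ≡ hasBit s (toℕ i)

trace : ∀ n u → ∃ (Trace n u)
trace n u with vertexView n u
... | inj₁ (j , refl) =
  nothing , λ i → trans (closedN-Bg n (j ↑ˡ r n) (i ↑ˡ r n)) (Mentry-numbers n j i)
... | inj₂ (c , refl) =
  just (toℕ (opposite c)) , λ i →
    trans (closedN-Bg n (n ↑ʳ c) (i ↑ˡ r n)) (trans (Mentry-bit-number n i c) (Bentry≡testBit n i c))

trace-realised : ∀ n → 0 < n → ∀ s → ∃ (λ u → Trace n u s) ⊎ (∀ (i : Fin n) → hasBit s (toℕ i) ≡ false)
trace-realised n 0<n nothing  = inj₁ (fromℕ< 0<n ↑ˡ r n , λ i →
  trans (closedN-Bg n (fromℕ< 0<n ↑ˡ r n) (i ↑ˡ r n)) (Mentry-numbers n (fromℕ< 0<n) i))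
trace-realised n _   (just a) with a <? r n
... | yes a<r = inj₁ (n ↑ʳ c , λ i →
  trans (closedN-Bg n (n ↑ʳ c) (i ↑ˡ r n)) (trans (Mentry-bit-number n i c)
    (trans (Bentry≡testBit n i c) (cong (λ k → testBit k (toℕ i)) position≡a))))
  where
  c : Fin (r n)
  c = opposite (fromℕ< a<r)
  position≡a : toℕ (opposite c) ≡ a
  position≡a = trans (cong toℕ (opposite-involutive (fromℕ< a<r))) (toℕ-fromℕ< a<r)
... | no  a≮r = inj₂ λ i → cong (_≡ᵇ 1) (bit-≥⌈log₂⌉ (toℕ<n i) (≮⇒≥ a≮r))

rowTrace : ∀ n row → ∃₂ λ s t → ∀ i → RA (Bg n) row (i ↑ˡ r n) ≡ indicator (hasBits s t (toℕ i))
rowTrace n (inj₁ u) with s , trace-u ← trace n u =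
  s , s , λ i → cong indicator (trans (trace-u i) (sym (∧-idem (hasBit s (toℕ i)))))
rowTrace n (inj₂ (u , v)) with s , trace-u ← trace n u | t , trace-v ← trace n v =
  s , t , λ i → cong indicator (cong₂ _∧_ (trace-u i) (trace-v i))

sumWhere : ∀ n → (ℕ → Bool) → (Fin n → ℚ) → ℚ
sumWhere n φ f = Σℚ n (λ i → indicator (φ (toℕ i)) *ℚ f i)

sumWhere-cong : ∀ n φ {f g : Fin n → ℚ} → (∀ i → f i ≡ g i) → sumWhere n φ f ≡ sumWhere n φ g
sumWhere-cong n φ f≗g = Σℚ-cong n λ i → cong (indicator (φ (toℕ i)) *ℚ_) (f≗g i)

BitBalanced : ∀ n → (Fin n → ℚ) → Set
BitBalanced n f = ∀ s t → sumWhere n (hasBits s t) f ≡ 0ℚ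

numberPart : ∀ n → (Fin (n + r n) → ℚ) → Fin n → ℚ
numberPart n x i = x (i ↑ˡ r n)

bitPart : ∀ n → (Fin (n + r n) → ℚ) → Fin (r n) → ℚ
bitPart n x c = x (n ↑ʳ c)

withZeroBits : ∀ n → (Fin n → ℚ) → Fin (n + r n) → ℚ
withZeroBits n f = f ++ λ _ → 0ℚ

rowSum : ∀ n → RARow (n + r n) → (Fin (n + r n) → ℚ) → ℚ
rowSum n row x = Σℚ (n + r n) (λ w → RA (Bg n) row w *ℚ x w)

rowSum-traced : ∀ n row x s t → (∀ c → x (n ↑ʳ c) ≡ 0ℚ) →
  (∀ i → RA (Bg n) row (i ↑ˡ r n) ≡ indicator (hasBits s t (toℕ i))) →
  rowSum n row x ≡ sumWhere n (hasBits s t) (numberPart n x)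
rowSum-traced n row x s t bits≡0 traced = begin
  rowSum n row x                                     ≡⟨ Σℚ-++ n (r n) (λ w → RA (Bg n) row w *ℚ x w) ⟩
  Σℚ n numberTerm +ℚ Σℚ (r n) bitTerm                ≡⟨ cong (Σℚ n numberTerm +ℚ_) bitTerms≡0 ⟩
  Σℚ n numberTerm +ℚ 0ℚ                              ≡⟨ ℚ.+-identityʳ (Σℚ n numberTerm) ⟩
  Σℚ n numberTerm                                    ≡⟨ Σℚ-cong n (λ i → cong (_*ℚ x (i ↑ˡ r n)) (traced i)) ⟩
  sumWhere n (hasBits s t) (numberPart n x)          ∎
  where
  open ≡-Reasoning
  numberTerm : Fin n → ℚ
  numberTerm i = RA (Bg n) row (i ↑ˡ r n) *ℚ x (i ↑ˡ r n)
  bitTerm : Fin (r n) → ℚ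
  bitTerm c = RA (Bg n) row (n ↑ʳ c) *ℚ x (n ↑ʳ c)
  bitTerms≡0 : Σℚ (r n) bitTerm ≡ 0ℚ
  bitTerms≡0 = Σℚ-zero (r n) λ c →
    trans (cong (RA (Bg n) row (n ↑ʳ c) *ℚ_) (bits≡0 c)) (ℚ.*-zeroʳ (RA (Bg n) row (n ↑ʳ c)))

bitBalanced⇒inKernel : ∀ n {f} → BitBalanced n f → InKernel (RA (Bg n)) (withZeroBits n f)
bitBalanced⇒inKernel n {f} balanced row with s , t , traced ← rowTrace n row = begin
  rowSum n row (withZeroBits n f)                           ≡⟨ rowSum-traced n row _ s t (lookup-++ʳ f _) traced ⟩
  sumWhere n (hasBits s t) (numberPart n (withZeroBits n f)) ≡⟨ sumWhere-cong n (hasBits s t) (lookup-++ˡ f _) ⟩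
  sumWhere n (hasBits s t) f                                ≡⟨ balanced s t ⟩
  0ℚ                                                        ∎
  where open ≡-Reasoning

bitRow : ∀ n → Fin n → (Fin (r n) → ℚ) → ℚ
bitRow n j y = Σℚ (r n) (λ c → indicator (Bentry n j c) *ℚ y c)

rowSum-numberVertex : ∀ n x (j : Fin n) →
  rowSum n (inj₁ (j ↑ˡ r n)) x ≡ Σℚ n (numberPart n x) +ℚ bitRow n j (bitPart n x)
rowSum-numberVertex n x j = trans (Σℚ-++ n (r n) (λ w → RA (Bg n) (inj₁ v) w *ℚ x w)) (cong₂ _+ℚ_
  (Σℚ-cong n λ i → trans
    (cong (λ b → indicator b *ℚ x (i ↑ˡ r n)) (trans (closedN-Bg n v (i ↑ˡ r n)) (Mentry-numbers n j i)))
    (ℚ.*-identityˡ (x (i ↑ˡ r n))))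
  (Σℚ-cong (r n) λ c →
    cong (λ b → indicator b *ℚ x (n ↑ʳ c)) (trans (closedN-Bg n v (n ↑ʳ c)) (Mentry-number-bit n j c))))
  where
  v : Fin (n + r n)
  v = j ↑ˡ r n

bitRow-0 : ∀ n (0<n : 0 < n) y → bitRow n (fromℕ< 0<n) y ≡ 0ℚ
bitRow-0 n 0<n y = Σℚ-zero (r n) λ c → trans
  (cong (λ b → indicator b *ℚ y c) (begin
    Bentry n (fromℕ< 0<n) c                          ≡⟨ Bentry≡testBit n (fromℕ< 0<n) c ⟩
    testBit (toℕ (opposite c)) (toℕ (fromℕ< 0<n))    ≡⟨ cong (testBit (toℕ (opposite c))) (toℕ-fromℕ< 0<n) ⟩
    testBit (toℕ (opposite c)) 0                     ≡⟨ cong (_≡ᵇ 1) (bit-of-0 (toℕ (opposite c))) ⟩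
    false                                            ∎))
  (ℚ.*-zeroˡ (y c))
  where open ≡-Reasoning

bitRow-2^ : ∀ n c₀ (2^k<n : 2 ^ toℕ (opposite c₀) < n) y → bitRow n (fromℕ< 2^k<n) y ≡ y c₀
bitRow-2^ n c₀ 2^k<n y = begin
  bitRow n (fromℕ< 2^k<n) y                                ≡⟨ Σℚ-single c₀ (λ c c≢c₀ → trans
    (cong (λ b → indicator b *ℚ y c) (trans (Bentry-2^ c) (dec-false (c Fin.≟ c₀) c≢c₀))) (ℚ.*-zeroˡ (y c))) ⟩
  indicator (Bentry n (fromℕ< 2^k<n) c₀) *ℚ y c₀          ≡⟨ cong (λ b → indicator b *ℚ y c₀)
                                                               (trans (Bentry-2^ c₀) (dec-true (c₀ Fin.≟ c₀) refl)) ⟩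
  1ℚ *ℚ y c₀                                               ≡⟨ ℚ.*-identityˡ (y c₀) ⟩
  y c₀                                                     ∎
  where
  open ≡-Reasoning
  Bentry-2^ : ∀ c → Bentry n (fromℕ< 2^k<n) c ≡ does (c Fin.≟ c₀)
  Bentry-2^ c = trans (Bentry≡testBit n (fromℕ< 2^k<n) c)
    (trans (cong (testBit (toℕ (opposite c))) (toℕ-fromℕ< 2^k<n)) digit)
    where
    digit : testBit (toℕ (opposite c)) (2 ^ toℕ (opposite c₀)) ≡ does (c Fin.≟ c₀)
    digit with c Fin.≟ c₀
    ... | yes refl = cong (_≡ᵇ 1) (bit-2^-same (toℕ (opposite c)))
    ... | no  c≢c₀ = cong (_≡ᵇ 1) (bit-2^-other _ _ λ eq → c≢c₀ (trans (sym (opposite-involutive c))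
      (trans (cong opposite (toℕ-injective eq)) (opposite-involutive c₀))))

inKernel⇒numberSum≡0 : ∀ n {x} → 0 < n → InKernel (RA (Bg n)) x → Σℚ n (numberPart n x) ≡ 0ℚ
inKernel⇒numberSum≡0 n {x} 0<n inKernel = begin
  Σℚ n (numberPart n x)                                    ≡⟨ ℚ.+-identityʳ (Σℚ n (numberPart n x)) ⟨
  Σℚ n (numberPart n x) +ℚ 0ℚ                              ≡⟨ cong (Σℚ n (numberPart n x) +ℚ_) (bitRow-0 n 0<n (bitPart n x)) ⟨
  Σℚ n (numberPart n x) +ℚ bitRow n (fromℕ< 0<n) (bitPart n x) ≡⟨ rowSum-numberVertex n x (fromℕ< 0<n) ⟨
  rowSum n (inj₁ (fromℕ< 0<n ↑ˡ r n)) x                    ≡⟨ inKernel (inj₁ (fromℕ< 0<n ↑ˡ r n)) ⟩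
  0ℚ                                                       ∎
  where open ≡-Reasoning

-- The rows N[0] and N[2^k] differ exactly in the bit vertex of position k.
inKernel⇒bitPart≡0 : ∀ n {x} → 0 < n → InKernel (RA (Bg n)) x → ∀ c → bitPart n x c ≡ 0ℚ
inKernel⇒bitPart≡0 n {x} 0<n inKernel c₀ = begin
  bitPart n x c₀                                                 ≡⟨ ℚ.+-identityˡ (bitPart n x c₀) ⟨
  0ℚ +ℚ bitPart n x c₀                                           ≡⟨ cong₂ _+ℚ_ (inKernel⇒numberSum≡0 n 0<n inKernel)
                                                                      (bitRow-2^ n c₀ 2^k<n (bitPart n x)) ⟨
  Σℚ n (numberPart n x) +ℚ bitRow n (fromℕ< 2^k<n) (bitPart n x) ≡⟨ rowSum-numberVertex n x (fromℕ< 2^k<n) ⟨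
  rowSum n (inj₁ (fromℕ< 2^k<n ↑ˡ r n)) x                        ≡⟨ inKernel (inj₁ (fromℕ< 2^k<n ↑ˡ r n)) ⟩
  0ℚ                                                             ∎
  where
  open ≡-Reasoning
  2^k<n : 2 ^ toℕ (opposite c₀) < n
  2^k<n = <⌈log₂⌉⇒2^< (toℕ<n (opposite c₀))

inKernel⇒bitBalanced : ∀ n {x} → 0 < n → InKernel (RA (Bg n)) x → BitBalanced n (numberPart n x)
inKernel⇒bitBalanced n {x} 0<n inKernel s t with trace-realised n 0<n s | trace-realised n 0<n t
... | inj₁ (u , trace-u) | inj₁ (v , trace-v) = trans
  (sym (rowSum-traced n (inj₂ (u , v)) x s t (inKernel⇒bitPart≡0 n 0<n inKernel)
    λ i → cong indicator (cong₂ _∧_ (trace-u i) (trace-v i))))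
  (inKernel (inj₂ (u , v)))
... | inj₂ s-empty | _ = Σℚ-zero n λ i → trans
  (cong (λ b → indicator (b ∧ hasBit t (toℕ i)) *ℚ x (i ↑ˡ r n)) (s-empty i))
  (ℚ.*-zeroˡ (x (i ↑ˡ r n)))
... | inj₁ _ | inj₂ t-empty = Σℚ-zero n λ i → trans
  (cong (λ b → indicator b *ℚ x (i ↑ˡ r n))
    (trans (cong (hasBit s (toℕ i) ∧_) (t-empty i)) (∧-zeroʳ (hasBit s (toℕ i)))))
  (ℚ.*-zeroˡ (x (i ↑ˡ r n)))

sumWhere-init-last : ∀ n φ (g : Fin (suc n) → ℚ) →
  sumWhere (suc n) φ g ≡ sumWhere n φ (init g) +ℚ indicator (φ n) *ℚ last g
sumWhere-init-last n φ g = trans (Σℚ-init-last n (λ i → indicator (φ (toℕ i)) *ℚ g i)) (cong₂ _+ℚ_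
  (Σℚ-cong n λ i → cong (λ k → indicator (φ k) *ℚ g (inject₁ i)) (toℕ-inject₁ i))
  (cong (λ k → indicator (φ k) *ℚ last g) (toℕ-fromℕ n)))

sumWhere-last≡0 : ∀ n φ {g : Fin (suc n) → ℚ} → last g ≡ 0ℚ →
  sumWhere (suc n) φ g ≡ sumWhere n φ (init g)
sumWhere-last≡0 n φ {g} last≡0 = trans (sumWhere-init-last n φ g) (trans
  (cong (λ y → sumWhere n φ (init g) +ℚ indicator (φ n) *ℚ y) last≡0)
  (trans (cong (sumWhere n φ (init g) +ℚ_) (ℚ.*-zeroʳ (indicator (φ n))))
    (ℚ.+-identityʳ (sumWhere n φ (init g)))))

bitBalanced-init : ∀ n {g} → BitBalanced (suc n) g → last g ≡ 0ℚ → BitBalanced n (init g)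
bitBalanced-init n {g} balanced last≡0 s t =
  trans (sym (sumWhere-last≡0 n (hasBits s t) {g} last≡0)) (balanced s t)

bitBalanced-extend₀ : ∀ n {f} → BitBalanced n f → BitBalanced (suc n) (extend₀ f)
bitBalanced-extend₀ n {f} balanced s t = begin
  sumWhere (suc n) (hasBits s t) (extend₀ f)      ≡⟨ sumWhere-last≡0 n (hasBits s t) {extend₀ f} (last-extend₀ f) ⟩
  sumWhere n (hasBits s t) (init (extend₀ f))     ≡⟨ sumWhere-cong n (hasBits s t) (init-extend₀ f) ⟩
  sumWhere n (hasBits s t) f                      ≡⟨ balanced s t ⟩
  0ℚ                                              ∎
  where open ≡-Reasoning

popcount<3⇒last≡0 : ∀ n {g} → 0 < n → popcount n < 3 → BitBalanced (suc n) g → last g ≡ 0ℚ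
popcount<3⇒last≡0 n {g} 0<n pop<3 balanced
  with a , b , ba , bb , least ← popcount<3⇒leastWithBits n 0<n pop<3 = begin
  last g                                        ≡⟨ ℚ.*-identityˡ (last g) ⟨
  indicator true *ℚ last g                      ≡⟨ cong (λ p → indicator p *ℚ last g) both-at-n ⟨
  indicator (φ n) *ℚ last g                     ≡⟨ ℚ.+-identityˡ (indicator (φ n) *ℚ last g) ⟨
  0ℚ +ℚ indicator (φ n) *ℚ last g               ≡⟨ cong (_+ℚ indicator (φ n) *ℚ last g) none-below ⟨
  sumWhere n φ (init g) +ℚ indicator (φ n) *ℚ last g ≡⟨ sumWhere-init-last n φ g ⟨
  sumWhere (suc n) φ g                          ≡⟨ balanced (just a) (just b) ⟩
  0ℚ                                            ∎
  where
  open ≡-Reasoning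
  φ : ℕ → Bool
  φ = hasBits (just a) (just b)
  both-at-n : φ n ≡ true
  both-at-n = cong₂ _∧_ (cong (_≡ᵇ 1) ba) (cong (_≡ᵇ 1) bb)
  not-below : ∀ j → j < n → φ j ≡ false
  not-below j j<n with testBit a j in aj | testBit b j in bj
  ... | true  | true  = contradiction (least j (testBit⇒bit≡1 a j aj) (testBit⇒bit≡1 b j bj)) (<⇒≱ j<n)
  ... | true  | false = refl
  ... | false | _     = refl
  none-below : sumWhere n φ (init g) ≡ 0ℚ
  none-below = Σℚ-zero n λ i → trans
    (cong (λ p → indicator p *ℚ init g i) (not-below (toℕ i) (toℕ<n i))) (ℚ.*-zeroˡ (init g i))

-- The sum over T ⊆ {a, b, c} of (-1)^|T| times the unit vector at n with the digits in T cleared.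
cubeVector : ∀ n → ℕ → ℕ → ℕ → Fin (suc n) → ℚ
cubeVector n a b c i = Δ³ a b c (λ p → indicator (toℕ i ≡ᵇ p)) n

sumWhere-cubeVector : ∀ n a b c φ → sumWhere (suc n) φ (cubeVector n a b c) ≡ Δ³ a b c (indicator ∘ φ) n
sumWhere-cubeVector n a b c φ = trans
  (Σℚ-Δ³ (suc n) a b c (λ i → indicator (φ (toℕ i))) (λ i p → indicator (toℕ i ≡ᵇ p)) n)
  (Δ³-cong-≤ a b c n λ q q≤n → trans (Σℚ-single (fromℕ< (s≤s q≤n)) (others q≤n)) (at q≤n))
  where
  others : ∀ {q} (q≤n : q ≤ n) i → i ≢ fromℕ< (s≤s q≤n) →
    indicator (φ (toℕ i)) *ℚ indicator (toℕ i ≡ᵇ q) ≡ 0ℚ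
  others q≤n i i≢q = trans
    (cong (indicator (φ (toℕ i)) *ℚ_) (cong indicator (dec-false (toℕ i ≟ _)
      λ i≡q → i≢q (toℕ-injective (trans i≡q (sym (toℕ-fromℕ< (s≤s q≤n))))))))
    (ℚ.*-zeroʳ (indicator (φ (toℕ i))))
  at : ∀ {q} (q≤n : q ≤ n) → let i = fromℕ< (s≤s q≤n) in
    indicator (φ (toℕ i)) *ℚ indicator (toℕ i ≡ᵇ q) ≡ indicator (φ q)
  at {q} q≤n rewrite toℕ-fromℕ< (s≤s q≤n) =
    trans (cong (λ p → indicator (φ q) *ℚ indicator p) (dec-true (q ≟ q) refl)) (ℚ.*-identityʳ (indicator (φ q)))

cubeVector-bitBalanced : ∀ n {a b c} → a < b → b < c → BitBalanced (suc n) (cubeVector n a b c)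
cubeVector-bitBalanced n {a} {b} {c} a<b b<c s t = trans (sumWhere-cubeVector n a b c (hasBits s t))
  (Δ³-ignored (Sum.map ignores (Sum.map ignores ignores)
    (pigeonhole (Maybe.≡-dec _≟_) (distinct a<b) (distinct (<-trans a<b b<c)) (distinct b<c) s t)) n)
  where
  distinct : ∀ {x y} → x < y → just x ≢ just y
  distinct x<y = <⇒≢ x<y ∘ just-injective
  ignores : ∀ {e} → s ≢ just e × t ≢ just e → IgnoresBit e (indicator ∘ hasBits s t)
  ignores (s≢e , t≢e) = hasBits-ignoresBit s≢e t≢e

last-cubeVector : ∀ n a b c → bit a n ≡ 1 → bit b n ≡ 1 → bit c n ≡ 1 → last (cubeVector n a b c) ≡ 1ℚ
last-cubeVector n a b c ba bb bc rewrite toℕ-fromℕ n =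
  trans (Δ³-top a b c below ba bb bc) (cong indicator (dec-true (n ≟ n) refl))
  where
  below : ∀ q → q < n → indicator (n ≡ᵇ q) ≡ 0ℚ
  below q q<n = cong indicator (dec-false (n ≟ q) (>⇒≢ q<n))

newVertex : ∀ n → Fin (suc n + r (suc n))
newVertex n = fromℕ n ↑ˡ r (suc n)

lift : ∀ n → (Fin (n + r n) → ℚ) → Fin (suc n + r (suc n)) → ℚ
lift n x = withZeroBits (suc n) (extend₀ (numberPart n x))

restrict : ∀ n → (Fin (suc n + r (suc n)) → ℚ) → Fin (n + r n) → ℚ
restrict n x = withZeroBits n (init (numberPart (suc n) x))

lift-number : ∀ n x i → lift n x (inject₁ i ↑ˡ r (suc n)) ≡ x (i ↑ˡ r n)
lift-number n x i = trans (lookup-++ˡ (extend₀ (numberPart n x)) _ (inject₁ i)) (init-extend₀ (numberPart n x) i)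

lift-newVertex : ∀ n x → lift n x (newVertex n) ≡ 0ℚ
lift-newVertex n x = trans (lookup-++ˡ (extend₀ (numberPart n x)) _ (fromℕ n)) (last-extend₀ (numberPart n x))

lift-inKernel : ∀ n {x} → 0 < n → InKernel (RA (Bg n)) x → InKernel (RA (Bg (suc n))) (lift n x)
lift-inKernel n 0<n x-inKernel =
  bitBalanced⇒inKernel (suc n) (bitBalanced-extend₀ n (inKernel⇒bitBalanced n 0<n x-inKernel))

restrict-inKernel : ∀ n {x} → InKernel (RA (Bg (suc n))) x → x (newVertex n) ≡ 0ℚ →
  InKernel (RA (Bg n)) (restrict n x)
restrict-inKernel n {x} x-inKernel x₀≡0 = bitBalanced⇒inKernel n
  (bitBalanced-init n {numberPart (suc n) x} (inKernel⇒bitBalanced (suc n) {x} 0<1+n x-inKernel) x₀≡0)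

liftedBasis : ∀ n {d} → 0 < n → KernelDim (RA (Bg n)) d → HyperplaneBasis (RA (Bg (suc n))) (newVertex n) d
liftedBasis n {d} 0<n (vs , vs-inKernel , vs-independent , vs-spans) = record
  { vectors     = lift n ∘ vs
  ; inKernel    = λ k → lift-inKernel n 0<n (vs-inKernel k)
  ; vanish      = λ k → lift-newVertex n (vs k)
  ; independent = λ c comb≡0 → vs-independent c (++-ext n {f = lincomb d vs c} {g = λ _ → 0ℚ}
                    (λ i → trans (sym (lincomb-lift c i)) (comb≡0 (inject₁ i ↑ˡ r (suc n))))
                    (λ b → lincomb-zero d vs c (n ↑ʳ b) λ k → inKernel⇒bitPart≡0 n 0<n (vs-inKernel k) b))
  ; spans       = spans′
  }
  where
  lincomb-lift : ∀ c i → lincomb d (lift n ∘ vs) c (inject₁ i ↑ˡ r (suc n)) ≡ lincomb d vs c (i ↑ˡ r n)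
  lincomb-lift c i = Σℚ-cong d λ k → cong (c k *ℚ_) (lift-number n (vs k) i)
  spans′ : ∀ x → InKernel (RA (Bg (suc n))) x → x (newVertex n) ≡ 0ℚ →
    ∃ λ c → ∀ w → x w ≡ lincomb d (lift n ∘ vs) c w
  spans′ x x-inKernel x₀≡0 = c , ++-ext (suc n) {f = x} {g = lincomb d (lift n ∘ vs) c}
    (init-last-ext {f = numberPart (suc n) x} {g = numberPart (suc n) (lincomb d (lift n ∘ vs) c)}
      (λ i → trans (sym (lookup-++ˡ (init (numberPart (suc n) x)) _ i))
        (trans (proj₂ decomposition (i ↑ˡ r n)) (sym (lincomb-lift c i))))
      (trans x₀≡0 (sym (lincomb-zero d (lift n ∘ vs) c (newVertex n) λ k → lift-newVertex n (vs k)))))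
    (λ b → trans (inKernel⇒bitPart≡0 (suc n) {x} 0<1+n x-inKernel b)
      (sym (lincomb-zero d (lift n ∘ vs) c (suc n ↑ʳ b) λ k → lookup-++ʳ (extend₀ (numberPart n (vs k))) _ b)))
    where
    decomposition : ∃ λ c → ∀ w → restrict n x w ≡ lincomb d vs c w
    decomposition = vs-spans (restrict n x) (restrict-inKernel n {x} x-inKernel x₀≡0)
    c : Fin d → ℚ
    c = proj₁ decomposition

mainTheorem4 : ∀ (n : ℕ) → 2 ≤ n → ∀ (d : ℕ) → KernelDim (RA (Bg n)) d →
    (3 ≤ popcount n → KernelDim (RA (Bg (suc n))) (suc d)) ×
    (popcount n < 3 → KernelDim (RA (Bg (suc n))) d)
mainTheorem4 n 2≤n d kernelDim = grows , stays
  where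
  0<n : 0 < n
  0<n = <-≤-trans (s≤s z≤n) 2≤n
  basis : HyperplaneBasis (RA (Bg (suc n))) (newVertex n) d
  basis = liftedBasis n 0<n kernelDim
  grows : 3 ≤ popcount n → KernelDim (RA (Bg (suc n))) (suc d)
  grows 3≤pop with a , b , c , a<b , b<c , ba , bb , bc ← popcount≥3⇒threeBits n 3≤pop =
    hyperplaneBasis⇒kernelDim-suc basis (withZeroBits (suc n) (cubeVector n a b c))
      (trans (lookup-++ˡ (cubeVector n a b c) _ (fromℕ n)) (last-cubeVector n a b c ba bb bc))
      (bitBalanced⇒inKernel (suc n) (cubeVector-bitBalanced n a<b b<c))
  stays : popcount n < 3 → KernelDim (RA (Bg (suc n))) d
  stays pop<3 = hyperplaneBasis⇒kernelDim basis λ x x-inKernel →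
    popcount<3⇒last≡0 n {numberPart (suc n) x} 0<n pop<3 (inKernel⇒bitBalanced (suc n) {x} 0<1+n x-inKernel)
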